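{- Let $J$ be a positive integer and $\ell$ an integer with $J\le\ell\le 2J$. Then \[ A_{J,J}^{(\ell)}=\frac{1}{J}\binom{2J}{J+1}\binom{J}{2J-\ell}\binom{\ell+1}{\ell-J} \] is odd if and only if $J=2^c-1$ for some positive integer $c$. -}

module Defs where

open import Data.Nat using (ℕ; _+_; _*_; _∸_; _/_; NonZero)
open import Data.Nat.Combinatorics using (_C_)

-- A^{(ℓ)}_{J,J} = (1/J) * C(2J, J+1) * C(J, 2J-ℓ) * C(ℓ+1, ℓ-J).
-- J divides C(2J,J+1) (C(2J,J+1)/J is the Catalan number), so the
-- truncated natural division below is exact.
A : (J ℓ : ℕ) → .{{NonZero J}} → ℕ
A J ℓ = (((2 * J) C (J + 1)) * (J C (2 * J ∸ ℓ)) * ((ℓ + 1) C (ℓ ∸ J))) / J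

-- A J ℓ = Cat J · C(J, 2J−ℓ) · C(ℓ+1, ℓ−J) with Cat J = C(2J, J+1)/J the Catalan number.
-- Modulo 2 Lucas's theorem holds, by Pascal's rule and (1+x)² ≡ 1+x². Since
-- (2n+1)·Cat(2n+1) = C(4n+2, 2n+2) ≡ C(2n+1, n+1) = (2n+1)·Cat n, and
-- (2n+3)·Cat(2n+2) = C(4n+4, 2n+2) ≡ C(2n+2, n+1) is even, Cat J is odd exactly when
-- J = 2^c − 1. For such J, C(J, k) is odd for all k ≤ J (J is all ones in binary), and
-- C(2^c + d, d) is odd for d = ℓ − J < 2^c (no carries), so then all three factors are odd.
module Submission where

open import Defs
open import Data.Nat
open import Data.Nat.Properties
open import Data.Nat.DivMod using (m*n/n≡m)
open import Data.Nat.Combinatorics using (_C_; nCk+nC[k+1]≡[n+1]C[k+1]; nCk≡nC[n∸k]; nC1≡n)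
open import Data.Nat.Induction using (<-rec)
open import Data.Parity.Base as ℙ using (0ℙ; 1ℙ; _⁻¹)
import Data.Parity.Properties as ℙ
open import Data.Product using (∃-syntax; _×_; _,_)
open import Function.Bundles using (_⇔_; mk⇔; Equivalence)
open import Relation.Binary.PropositionalEquality
open import Relation.Nullary using (contradiction)
open ≡-Reasoning

x+y+[y+z]≡x+z : ∀ x y z → (x ℙ.+ y) ℙ.+ (y ℙ.+ z) ≡ x ℙ.+ z
x+y+[y+z]≡x+z x y z = begin
  (x ℙ.+ y) ℙ.+ (y ℙ.+ z)  ≡⟨ ℙ.+-assoc x y (y ℙ.+ z) ⟩
  x ℙ.+ (y ℙ.+ (y ℙ.+ z))  ≡⟨ cong (x ℙ.+_) (ℙ.+-assoc y y z) ⟨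
  x ℙ.+ ((y ℙ.+ y) ℙ.+ z)  ≡⟨ cong (λ w → x ℙ.+ (w ℙ.+ z)) (ℙ.p+p≡0ℙ y) ⟩
  x ℙ.+ z                  ∎

p*q≡1ℙ⇒p≡1ℙ : ∀ {p q} → p ℙ.* q ≡ 1ℙ → p ≡ 1ℙ
p*q≡1ℙ⇒p≡1ℙ {1ℙ} _ = refl

parity-suc : ∀ n → parity (suc n) ≡ parity n ⁻¹
parity-suc zero = refl
parity-suc (suc zero) = refl
parity-suc (suc (suc n)) = parity-suc n

parity-homo-+ : ∀ m n → parity (m + n) ≡ parity m ℙ.+ parity n
parity-homo-+ zero n = refl
parity-homo-+ (suc zero) n = parity-suc n
parity-homo-+ (suc (suc m)) n = parity-homo-+ m n

parity-homo-* : ∀ m n → parity (m * n) ≡ parity m ℙ.* parity n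
parity-homo-* zero n = refl
parity-homo-* (suc zero) n = cong parity (+-identityʳ n)
parity-homo-* (suc (suc m)) n = begin
  parity (n + (n + m * n))                      ≡⟨ parity-homo-+ n (n + m * n) ⟩
  parity n ℙ.+ parity (n + m * n)               ≡⟨ cong (parity n ℙ.+_) (parity-homo-+ n (m * n)) ⟩
  parity n ℙ.+ (parity n ℙ.+ parity (m * n))    ≡⟨ x+y+[y+z]≡x+z 0ℙ (parity n) (parity (m * n)) ⟩
  parity (m * n)                                ≡⟨ parity-homo-* m n ⟩
  parity m ℙ.* parity n                         ∎

parity[2n]≡0ℙ : ∀ n → parity (2 * n) ≡ 0ℙ
parity[2n]≡0ℙ n = parity-homo-* 2 n

parity[1+2n]≡1ℙ : ∀ n → parity (suc (2 * n)) ≡ 1ℙ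
parity[1+2n]≡1ℙ n = trans (parity-suc (2 * n)) (cong _⁻¹ (parity[2n]≡0ℙ n))

parity[[1+2n]*m]≡parity[m] : ∀ n m → parity (suc (2 * n) * m) ≡ parity m
parity[[1+2n]*m]≡parity[m] n m = trans (parity-homo-* (suc (2 * n)) m) (cong (ℙ._* parity m) (parity[1+2n]≡1ℙ n))

n%2≡1⇔parity[n]≡1ℙ : ∀ n → n % 2 ≡ 1 ⇔ parity n ≡ 1ℙ
n%2≡1⇔parity[n]≡1ℙ zero = mk⇔ (λ ()) (λ ())
n%2≡1⇔parity[n]≡1ℙ (suc zero) = mk⇔ (λ _ → refl) (λ _ → refl)
n%2≡1⇔parity[n]≡1ℙ (suc (suc n)) = n%2≡1⇔parity[n]≡1ℙ n

data EvenOrOdd : ℕ → Set where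
  even : ∀ n → EvenOrOdd (2 * n)
  odd  : ∀ n → EvenOrOdd (suc (2 * n))

evenOrOdd : ∀ n → EvenOrOdd n
evenOrOdd zero = even 0
evenOrOdd (suc n) with evenOrOdd n
... | even m = odd m
... | odd m = subst EvenOrOdd (*-suc 2 m) (even (suc m))

[2n]∸n≡n : ∀ n → 2 * n ∸ n ≡ n
[2n]∸n≡n n = trans (cong (λ m → n + m ∸ n) (+-identityʳ n)) (m+n∸m≡n n n)

2m≤1+2n⇒m≤n : ∀ {m n} → 2 * m ≤ suc (2 * n) → m ≤ n
2m≤1+2n⇒m≤n {m} {n} 2m≤1+2n = s≤s⁻¹ (*-cancelˡ-< 2 m (suc n) (subst (2 * m <_) (sym (*-suc 2 n)) (s≤s 2m≤1+2n)))

m≤n⇒2m∸n≤m : ∀ {m n} → m ≤ n → 2 * m ∸ n ≤ m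
m≤n⇒2m∸n≤m {m} {n} m≤n = subst (2 * m ∸ n ≤_) ([2n]∸n≡n m) (∸-monoʳ-≤ (2 * m) m≤n)

n≤2m⇒n∸m≤m : ∀ {m n} → n ≤ 2 * m → n ∸ m ≤ m
n≤2m⇒n∸m≤m {m} {n} n≤2m = subst (n ∸ m ≤_) ([2n]∸n≡n m) (∸-monoˡ-≤ m n≤2m)

m≤n⇒n+1≡1+m+[n∸m] : ∀ {m n} → m ≤ n → n + 1 ≡ suc m + (n ∸ m)
m≤n⇒n+1≡1+m+[n∸m] {m} {n} m≤n = trans (+-comm n 1) (cong suc (sym (m+[n∸m]≡n m≤n)))

parity-pascal : ∀ n k → parity (suc n C suc k) ≡ parity (n C k) ℙ.+ parity (n C suc k)
parity-pascal n k = trans (cong parity (sym (nCk+nC[k+1]≡[n+1]C[k+1] n k))) (parity-homo-+ (n C k) (n C suc k))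

parity-pascal² : ∀ n k → parity ((2 + n) C (2 + k)) ≡ parity (n C k) ℙ.+ parity (n C (2 + k))
parity-pascal² n k = begin
  parity ((2 + n) C (2 + k))
    ≡⟨ parity-pascal (suc n) (suc k) ⟩
  parity (suc n C suc k) ℙ.+ parity (suc n C (2 + k))
    ≡⟨ cong₂ ℙ._+_ (parity-pascal n k) (parity-pascal n (suc k)) ⟩
  (parity (n C k) ℙ.+ parity (n C suc k)) ℙ.+ (parity (n C suc k) ℙ.+ parity (n C (2 + k)))
    ≡⟨ x+y+[y+z]≡x+z (parity (n C k)) (parity (n C suc k)) (parity (n C (2 + k))) ⟩
  parity (n C k) ℙ.+ parity (n C (2 + k))
    ∎

lucas-even-odd : ∀ a b → parity (2 * a C suc (2 * b)) ≡ 0ℙ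
lucas-even-odd zero b = refl
lucas-even-odd (suc a) zero = trans (cong parity (nC1≡n (2 * suc a))) (parity[2n]≡0ℙ (suc a))
lucas-even-odd (suc a) (suc b) = begin
  parity (2 * suc a C suc (2 * suc b))
    ≡⟨ cong₂ (λ n k → parity (n C suc k)) (*-suc 2 a) (*-suc 2 b) ⟩
  parity ((2 + 2 * a) C (2 + suc (2 * b)))
    ≡⟨ parity-pascal² (2 * a) (suc (2 * b)) ⟩
  parity (2 * a C suc (2 * b)) ℙ.+ parity (2 * a C suc (2 + 2 * b))
    ≡⟨ cong (λ k → parity (2 * a C suc (2 * b)) ℙ.+ parity (2 * a C suc k)) (*-suc 2 b) ⟨
  parity (2 * a C suc (2 * b)) ℙ.+ parity (2 * a C suc (2 * suc b))
    ≡⟨ cong₂ ℙ._+_ (lucas-even-odd a b) (lucas-even-odd a (suc b)) ⟩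
  0ℙ
    ∎

lucas-even-even : ∀ a b → parity (2 * a C 2 * b) ≡ parity (a C b)
lucas-even-even zero zero = refl
lucas-even-even zero (suc b) = refl
lucas-even-even (suc a) zero = refl
lucas-even-even (suc a) (suc b) = begin
  parity (2 * suc a C 2 * suc b)
    ≡⟨ cong₂ (λ n k → parity (n C k)) (*-suc 2 a) (*-suc 2 b) ⟩
  parity ((2 + 2 * a) C (2 + 2 * b))
    ≡⟨ parity-pascal² (2 * a) (2 * b) ⟩
  parity (2 * a C 2 * b) ℙ.+ parity (2 * a C (2 + 2 * b))
    ≡⟨ cong (λ k → parity (2 * a C 2 * b) ℙ.+ parity (2 * a C k)) (*-suc 2 b) ⟨
  parity (2 * a C 2 * b) ℙ.+ parity (2 * a C 2 * suc b)
    ≡⟨ cong₂ ℙ._+_ (lucas-even-even a b) (lucas-even-even a (suc b)) ⟩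
  parity (a C b) ℙ.+ parity (a C suc b)
    ≡⟨ parity-pascal a b ⟨
  parity (suc a C suc b)
    ∎

lucas-odd-even : ∀ a b → parity (suc (2 * a) C 2 * b) ≡ parity (a C b)
lucas-odd-even a zero = refl
lucas-odd-even a (suc b) = begin
  parity (suc (2 * a) C 2 * suc b)
    ≡⟨ cong (λ k → parity (suc (2 * a) C k)) (*-suc 2 b) ⟩
  parity (suc (2 * a) C (2 + 2 * b))
    ≡⟨ parity-pascal (2 * a) (suc (2 * b)) ⟩
  parity (2 * a C suc (2 * b)) ℙ.+ parity (2 * a C (2 + 2 * b))
    ≡⟨ cong (λ k → parity (2 * a C suc (2 * b)) ℙ.+ parity (2 * a C k)) (*-suc 2 b) ⟨
  parity (2 * a C suc (2 * b)) ℙ.+ parity (2 * a C 2 * suc b)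
    ≡⟨ cong₂ ℙ._+_ (lucas-even-odd a b) (lucas-even-even a (suc b)) ⟩
  parity (a C suc b)
    ∎

lucas-odd-odd : ∀ a b → parity (suc (2 * a) C suc (2 * b)) ≡ parity (a C b)
lucas-odd-odd a b = begin
  parity (suc (2 * a) C suc (2 * b))
    ≡⟨ parity-pascal (2 * a) (2 * b) ⟩
  parity (2 * a C 2 * b) ℙ.+ parity (2 * a C suc (2 * b))
    ≡⟨ cong₂ ℙ._+_ (lucas-even-even a b) (lucas-even-odd a b) ⟩
  parity (a C b) ℙ.+ 0ℙ
    ≡⟨ ℙ.+-identityʳ (parity (a C b)) ⟩
  parity (a C b)
    ∎

[k+1]*[n+1]C[k+1]≡[n+1]*nCk : ∀ n k → suc k * (suc n C suc k) ≡ suc n * (n C k)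
[k+1]*[n+1]C[k+1]≡[n+1]*nCk zero zero = refl
[k+1]*[n+1]C[k+1]≡[n+1]*nCk zero (suc k) = *-zeroʳ (2 + k)
[k+1]*[n+1]C[k+1]≡[n+1]*nCk (suc n) zero = trans (+-identityʳ _) (trans (nC1≡n (2 + n)) (sym (*-identityʳ (2 + n))))
[k+1]*[n+1]C[k+1]≡[n+1]*nCk (suc n) (suc k) = begin
  (2 + k) * ((2 + n) C (2 + k))
    ≡⟨ cong ((2 + k) *_) (nCk+nC[k+1]≡[n+1]C[k+1] (suc n) (suc k)) ⟨
  (2 + k) * (X + suc n C (2 + k))
    ≡⟨ *-distribˡ-+ (2 + k) X (suc n C (2 + k)) ⟩
  X + suc k * X + (2 + k) * (suc n C (2 + k))
    ≡⟨ cong₂ (λ u v → X + u + v) ([k+1]*[n+1]C[k+1]≡[n+1]*nCk n k) ([k+1]*[n+1]C[k+1]≡[n+1]*nCk n (suc k)) ⟩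
  X + suc n * (n C k) + suc n * (n C suc k)
    ≡⟨ +-assoc X (suc n * (n C k)) (suc n * (n C suc k)) ⟩
  X + (suc n * (n C k) + suc n * (n C suc k))
    ≡⟨ cong (X +_) (*-distribˡ-+ (suc n) (n C k) (n C suc k)) ⟨
  X + suc n * (n C k + n C suc k)
    ≡⟨ cong (λ u → X + suc n * u) (nCk+nC[k+1]≡[n+1]C[k+1] n k) ⟩
  (2 + n) * X
    ∎
  where
  X : ℕ
  X = suc n C suc k

[1+2n]C[1+n]≡[1+2n]Cn : ∀ n → suc (2 * n) C suc n ≡ suc (2 * n) C n
[1+2n]C[1+n]≡[1+2n]Cn n = trans (nCk≡nC[n∸k] (s≤s (m≤m+n n (n + 0)))) (cong (suc (2 * n) C_) ([2n]∸n≡n n))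

n*[2n]Cn≡[1+n]*[2n]C[1+n] : ∀ n → n * (2 * n C n) ≡ suc n * (2 * n C suc n)
n*[2n]Cn≡[1+n]*[2n]C[1+n] zero = refl
n*[2n]Cn≡[1+n]*[2n]C[1+n] (suc n) = begin
  suc n * (2 * suc n C suc n)
    ≡⟨ cong (λ m → suc n * (m C suc n)) (*-suc 2 n) ⟩
  suc n * (suc N C suc n)
    ≡⟨ [k+1]*[n+1]C[k+1]≡[n+1]*nCk N n ⟩
  suc N * (N C n)
    ≡⟨ cong (suc N *_) ([1+2n]C[1+n]≡[1+2n]Cn n) ⟨
  suc N * (N C suc n)
    ≡⟨ [k+1]*[n+1]C[k+1]≡[n+1]*nCk N (suc n) ⟨
  (2 + n) * (suc N C (2 + n))
    ≡⟨ cong (λ m → (2 + n) * (m C (2 + n))) (*-suc 2 n) ⟨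
  (2 + n) * (2 * suc n C (2 + n))
    ∎
  where
  N : ℕ
  N = suc (2 * n)

parity[[2+2n]C[1+n]]≡0ℙ : ∀ n → parity (2 * suc n C suc n) ≡ 0ℙ
parity[[2+2n]C[1+n]]≡0ℙ n = begin
  parity (2 * suc n C suc n)
    ≡⟨ cong (λ m → parity (m C suc n)) (*-suc 2 n) ⟩
  parity (suc N C suc n)
    ≡⟨ parity-pascal N n ⟩
  parity (N C n) ℙ.+ parity (N C suc n)
    ≡⟨ cong (λ m → parity (N C n) ℙ.+ parity m) ([1+2n]C[1+n]≡[1+2n]Cn n) ⟩
  parity (N C n) ℙ.+ parity (N C n)
    ≡⟨ ℙ.p+p≡0ℙ (parity (N C n)) ⟩
  0ℙ
    ∎
  where
  N : ℕ
  N = suc (2 * n)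

-- The Catalan number in a form that needs no division.
catalan : ℕ → ℕ
catalan n = 2 * n C n ∸ 2 * n C suc n

n*catalan[n]≡[2n]C[1+n] : ∀ n → n * catalan n ≡ 2 * n C suc n
n*catalan[n]≡[2n]C[1+n] n = begin
  n * (X ∸ Y)        ≡⟨ *-distribˡ-∸ n X Y ⟩
  n * X ∸ n * Y      ≡⟨ cong (_∸ n * Y) (n*[2n]Cn≡[1+n]*[2n]C[1+n] n) ⟩
  Y + n * Y ∸ n * Y  ≡⟨ m+n∸n≡m Y (n * Y) ⟩
  Y                  ∎
  where
  X Y : ℕ
  X = 2 * n C n
  Y = 2 * n C suc n

[1+n]*catalan[n]≡[2n]Cn : ∀ n → suc n * catalan n ≡ 2 * n C n
[1+n]*catalan[n]≡[2n]Cn n = begin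
  suc n * (X ∸ Y)          ≡⟨ *-distribˡ-∸ (suc n) X Y ⟩
  suc n * X ∸ suc n * Y    ≡⟨ cong (suc n * X ∸_) (n*[2n]Cn≡[1+n]*[2n]C[1+n] n) ⟨
  X + n * X ∸ n * X        ≡⟨ m+n∸n≡m X (n * X) ⟩
  X                        ∎
  where
  X Y : ℕ
  X = 2 * n C n
  Y = 2 * n C suc n

[1+2n]*catalan[n]≡[1+2n]C[1+n] : ∀ n → suc (2 * n) * catalan n ≡ suc (2 * n) C suc n
[1+2n]*catalan[n]≡[1+2n]C[1+n] n = begin
  suc (2 * n) * catalan n
    ≡⟨ cong (λ m → suc (n + m) * catalan n) (+-identityʳ n) ⟩
  (suc n + n) * catalan n
    ≡⟨ *-distribʳ-+ (catalan n) (suc n) n ⟩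
  suc n * catalan n + n * catalan n
    ≡⟨ cong₂ _+_ ([1+n]*catalan[n]≡[2n]Cn n) (n*catalan[n]≡[2n]C[1+n] n) ⟩
  2 * n C n + 2 * n C suc n
    ≡⟨ nCk+nC[k+1]≡[n+1]C[k+1] (2 * n) n ⟩
  suc (2 * n) C suc n
    ∎

parity[catalan[1+2n]]≡parity[catalan[n]] : ∀ n → parity (catalan (suc (2 * n))) ≡ parity (catalan n)
parity[catalan[1+2n]]≡parity[catalan[n]] n = begin
  parity (catalan N)          ≡⟨ parity[[1+2n]*m]≡parity[m] n (catalan N) ⟨
  parity (N * catalan N)      ≡⟨ cong parity (n*catalan[n]≡[2n]C[1+n] N) ⟩
  parity (2 * N C suc N)      ≡⟨ cong (λ k → parity (2 * N C k)) (*-suc 2 n) ⟨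
  parity (2 * N C 2 * suc n)  ≡⟨ lucas-even-even N (suc n) ⟩
  parity (N C suc n)          ≡⟨ cong parity ([1+2n]*catalan[n]≡[1+2n]C[1+n] n) ⟨
  parity (N * catalan n)      ≡⟨ parity[[1+2n]*m]≡parity[m] n (catalan n) ⟩
  parity (catalan n)          ∎
  where
  N : ℕ
  N = suc (2 * n)

parity[catalan[2+2n]]≡0ℙ : ∀ n → parity (catalan (2 * suc n)) ≡ 0ℙ
parity[catalan[2+2n]]≡0ℙ n = begin
  parity (catalan M)          ≡⟨ parity[[1+2n]*m]≡parity[m] (suc n) (catalan M) ⟨
  parity (suc M * catalan M)  ≡⟨ cong parity ([1+n]*catalan[n]≡[2n]Cn M) ⟩
  parity (2 * M C M)          ≡⟨ lucas-even-even M (suc n) ⟩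
  parity (M C suc n)          ≡⟨ parity[[2+2n]C[1+n]]≡0ℙ n ⟩
  0ℙ                          ∎
  where
  M : ℕ
  M = 2 * suc n

mersenne : ℕ → ℕ
mersenne zero = 0
mersenne (suc c) = suc (2 * mersenne c)

1+mersenne[c]≡2^c : ∀ c → suc (mersenne c) ≡ 2 ^ c
1+mersenne[c]≡2^c zero = refl
1+mersenne[c]≡2^c (suc c) = trans (sym (*-suc 2 (mersenne c))) (cong (2 *_) (1+mersenne[c]≡2^c c))

mersenne[c]≡2^c∸1 : ∀ c → mersenne c ≡ 2 ^ c ∸ 1
mersenne[c]≡2^c∸1 c = cong (_∸ 1) (1+mersenne[c]≡2^c c)

parity[catalan[mersenne[c]]]≡1ℙ : ∀ c → parity (catalan (mersenne c)) ≡ 1ℙ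
parity[catalan[mersenne[c]]]≡1ℙ zero = refl
parity[catalan[mersenne[c]]]≡1ℙ (suc c) =
  trans (parity[catalan[1+2n]]≡parity[catalan[n]] (mersenne c)) (parity[catalan[mersenne[c]]]≡1ℙ c)

parity[catalan[n]]≡1ℙ⇒n≡mersenne : ∀ n → parity (catalan n) ≡ 1ℙ → ∃[ c ] n ≡ mersenne c
parity[catalan[n]]≡1ℙ⇒n≡mersenne = <-rec _ step
  where
  step : ∀ n → (∀ {m} → m < n → parity (catalan m) ≡ 1ℙ → ∃[ c ] m ≡ mersenne c) →
         parity (catalan n) ≡ 1ℙ → ∃[ c ] n ≡ mersenne c
  step n rec odd-catalan with evenOrOdd n
  ... | even zero = 0 , refl
  ... | even (suc m) with () ← trans (sym odd-catalan) (parity[catalan[2+2n]]≡0ℙ m)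
  ... | odd m with rec (s≤s (m≤m+n m (m + 0))) (trans (sym (parity[catalan[1+2n]]≡parity[catalan[n]] m)) odd-catalan)
  ...   | c , refl = suc c , refl

parity[mersenne[c]Ck]≡1ℙ : ∀ c {k} → k ≤ mersenne c → parity (mersenne c C k) ≡ 1ℙ
parity[mersenne[c]Ck]≡1ℙ zero z≤n = refl
parity[mersenne[c]Ck]≡1ℙ (suc c) {k} k≤ with evenOrOdd k
... | even m = trans (lucas-odd-even (mersenne c) m) (parity[mersenne[c]Ck]≡1ℙ c {m} (2m≤1+2n⇒m≤n k≤))
... | odd m = trans (lucas-odd-odd (mersenne c) m) (parity[mersenne[c]Ck]≡1ℙ c {m} (*-cancelˡ-≤ 2 (s≤s⁻¹ k≤)))

parity[[2^c+m]Cm]≡1ℙ : ∀ c {m} → m < 2 ^ c → parity ((2 ^ c + m) C m) ≡ 1ℙ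
parity[[2^c+m]Cm]≡1ℙ zero {zero} _ = refl
parity[[2^c+m]Cm]≡1ℙ zero {suc m} (s≤s ())
parity[[2^c+m]Cm]≡1ℙ (suc c) {m} m< with evenOrOdd m
... | even r = begin
  parity ((2 * 2 ^ c + 2 * r) C (2 * r))   ≡⟨ cong (λ n → parity (n C (2 * r))) (*-distribˡ-+ 2 (2 ^ c) r) ⟨
  parity (2 * (2 ^ c + r) C (2 * r))       ≡⟨ lucas-even-even (2 ^ c + r) r ⟩
  parity ((2 ^ c + r) C r)                 ≡⟨ parity[[2^c+m]Cm]≡1ℙ c (*-cancelˡ-< 2 r (2 ^ c) m<) ⟩
  1ℙ                                       ∎
... | odd r = begin
  parity ((2 * 2 ^ c + suc (2 * r)) C suc (2 * r))
    ≡⟨ cong (λ n → parity (n C suc (2 * r))) (+-suc (2 * 2 ^ c) (2 * r)) ⟩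
  parity (suc (2 * 2 ^ c + 2 * r) C suc (2 * r))
    ≡⟨ cong (λ n → parity (suc n C suc (2 * r))) (*-distribˡ-+ 2 (2 ^ c) r) ⟨
  parity (suc (2 * (2 ^ c + r)) C suc (2 * r))
    ≡⟨ lucas-odd-odd (2 ^ c + r) r ⟩
  parity ((2 ^ c + r) C r)
    ≡⟨ parity[[2^c+m]Cm]≡1ℙ c (*-cancelˡ-< 2 r (2 ^ c) (<⇒≤ m<)) ⟩
  1ℙ
    ∎

A≡catalan*C*C : ∀ J ℓ .{{_ : NonZero J}} → A J ℓ ≡ catalan J * (J C (2 * J ∸ ℓ)) * ((ℓ + 1) C (ℓ ∸ J))
A≡catalan*C*C J ℓ = begin
  ((2 * J C (J + 1)) * Y * Z) / J     ≡⟨ cong (λ k → ((2 * J C k) * Y * Z) / J) (+-comm J 1) ⟩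
  ((2 * J C suc J) * Y * Z) / J       ≡⟨ cong (λ x → (x * Y * Z) / J) (n*catalan[n]≡[2n]C[1+n] J) ⟨
  (J * catalan J * Y * Z) / J         ≡⟨ cong (_/ J) J*c*Y*Z≡c*Y*Z*J ⟩
  (catalan J * Y * Z * J) / J         ≡⟨ m*n/n≡m (catalan J * Y * Z) J ⟩
  catalan J * Y * Z                   ∎
  where
  Y Z : ℕ
  Y = J C (2 * J ∸ ℓ)
  Z = (ℓ + 1) C (ℓ ∸ J)
  J*c*Y*Z≡c*Y*Z*J : J * catalan J * Y * Z ≡ catalan J * Y * Z * J
  J*c*Y*Z≡c*Y*Z*J = trans (cong (_* Z) (*-assoc J (catalan J) Y))
                   (trans (*-assoc J (catalan J * Y) Z) (*-comm J (catalan J * Y * Z)))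

parity[A]≡parity[catalan]*parity[C]*parity[C] : ∀ J ℓ .{{_ : NonZero J}} →
  parity (A J ℓ) ≡ parity (catalan J) ℙ.* parity (J C (2 * J ∸ ℓ)) ℙ.* parity ((ℓ + 1) C (ℓ ∸ J))
parity[A]≡parity[catalan]*parity[C]*parity[C] J ℓ = begin
  parity (A J ℓ)                                ≡⟨ cong parity (A≡catalan*C*C J ℓ) ⟩
  parity (catalan J * Y * Z)                    ≡⟨ parity-homo-* (catalan J * Y) Z ⟩
  parity (catalan J * Y) ℙ.* parity Z           ≡⟨ cong (ℙ._* parity Z) (parity-homo-* (catalan J) Y) ⟩
  parity (catalan J) ℙ.* parity Y ℙ.* parity Z  ∎
  where
  Y Z : ℕ
  Y = J C (2 * J ∸ ℓ)
  Z = (ℓ + 1) C (ℓ ∸ J)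

parity[catalan]*parity[C]*parity[C]≡1ℙ : ∀ c {J ℓ} → J ≡ mersenne c → J ≤ ℓ → ℓ ≤ 2 * J →
  parity (catalan J) ℙ.* parity (J C (2 * J ∸ ℓ)) ℙ.* parity ((ℓ + 1) C (ℓ ∸ J)) ≡ 1ℙ
parity[catalan]*parity[C]*parity[C]≡1ℙ c {ℓ = ℓ} refl M≤ℓ ℓ≤2M =
  cong₂ ℙ._*_ (cong₂ ℙ._*_ (parity[catalan[mersenne[c]]]≡1ℙ c) (parity[mersenne[c]Ck]≡1ℙ c (m≤n⇒2m∸n≤m M≤ℓ))) (begin
    parity ((ℓ + 1) C (ℓ ∸ M))         ≡⟨ cong (λ n → parity (n C (ℓ ∸ M))) (m≤n⇒n+1≡1+m+[n∸m] M≤ℓ) ⟩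
    parity ((suc M + (ℓ ∸ M)) C (ℓ ∸ M))  ≡⟨ cong (λ n → parity ((n + (ℓ ∸ M)) C (ℓ ∸ M))) (1+mersenne[c]≡2^c c) ⟩
    parity ((2 ^ c + (ℓ ∸ M)) C (ℓ ∸ M))  ≡⟨ parity[[2^c+m]Cm]≡1ℙ c ℓ∸M<2^c ⟩
    1ℙ                                    ∎)
  where
  M : ℕ
  M = mersenne c
  ℓ∸M<2^c : ℓ ∸ M < 2 ^ c
  ℓ∸M<2^c = subst (ℓ ∸ M <_) (1+mersenne[c]≡2^c c) (s≤s (n≤2m⇒n∸m≤m ℓ≤2M))

lemma3p6 : (J ℓ : ℕ) → .{{_ : NonZero J}} → J ≤ ℓ → ℓ ≤ 2 * J →
    ((A J ℓ % 2 ≡ 1) ⇔ (∃[ c ] (1 ≤ c × J ≡ 2 ^ c ∸ 1)))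
lemma3p6 J ℓ J≤ℓ ℓ≤2J = mk⇔ only-if if
  where
  open Equivalence (n%2≡1⇔parity[n]≡1ℙ (A J ℓ))
  parity[A]≡ : parity (A J ℓ) ≡ parity (catalan J) ℙ.* parity (J C (2 * J ∸ ℓ)) ℙ.* parity ((ℓ + 1) C (ℓ ∸ J))
  parity[A]≡ = parity[A]≡parity[catalan]*parity[C]*parity[C] J ℓ

  only-if : A J ℓ % 2 ≡ 1 → ∃[ c ] (1 ≤ c × J ≡ 2 ^ c ∸ 1)
  only-if A-odd with parity[catalan[n]]≡1ℙ⇒n≡mersenne J
                       (p*q≡1ℙ⇒p≡1ℙ (p*q≡1ℙ⇒p≡1ℙ (trans (sym parity[A]≡) (to A-odd))))
  ... | zero , J≡0 = contradiction J≡0 (≢-nonZero⁻¹ J)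
  ... | suc c , J≡mersenne = suc c , s≤s z≤n , trans J≡mersenne (mersenne[c]≡2^c∸1 (suc c))

  if : ∃[ c ] (1 ≤ c × J ≡ 2 ^ c ∸ 1) → A J ℓ % 2 ≡ 1
  if (c , _ , J≡2^c∸1) = from (trans parity[A]≡
    (parity[catalan]*parity[C]*parity[C]≡1ℙ c (trans J≡2^c∸1 (sym (mersenne[c]≡2^c∸1 c))) J≤ℓ ℓ≤2J))
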